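{- Let $\Gamma=(V,E)$, $B$, $\mathbb{K}$, $u$ be as in the context, and let $\mathcal{A}(\Gamma,u)$ be indexed by $E\cup\{e_0\}$ with a fixed total order in which $e_0$ is minimal. Suppose that $X_1$ and $X_2$ are crossings such that no vertex in $V\setminus B$ is met by both $X_1$ and $X_2$, and let $C=X_1\cup X_2$. Then in the exterior algebra $\mathcal{E}$, $$\partial(e_C)\in\langle \partial(e_{\{e_0\}\cup X_1}),\ \partial(e_{\{e_0\}\cup X_2})\rangle.$$
   Context: $\Gamma=(V,E)$ is a finite connected graph without loops or multiple edges; $B\subseteq V$ is a set of at least $2$ pairwise nonadjacent vertices (boundary nodes); $\mathbb{K}$ is a field of characteristic $0$; $u:B\to\mathbb{K}$ is injective. $\mathcal{A}(\Gamma,u)$ is the central arrangement in $\mathbb{K}^{(V\setminus B)\cup\{0\}}$ consisting of: for each edge $ij\in E$ with no endpoint in $B$, the hyperplane $x_i=x_j$; for each edge $ij$ with $j\in B$, the hyperplane $x_i=u(j)x_0$; and the hyperplane $x_0=0$, indexed by a new symbol $e_0$. A crossing is a subset $X\subseteq E$ which is the edge set of a minimal path in $\Gamma$ between two distinct boundary nodes. $\mathcal{E}$ is the exterior algebra over $\mathbb{K}$ with generators $e_a$, $a\in E\cup\{e_0\}$; for $S=\{a_1<\dots<a_p\}$, $e_S=e_{a_1}\cdots e_{a_p}$. $\partial:\mathcal{E}\to\mathcal{E}$ is the linear map with $\partial1=0$, $\partial e_a=1$, and $\partial(xy)=\partial(x)y+(-1)^px\partial(y)$ for $x$ homogeneous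 of degree $p$. -}

module Defs where

open import Level using (Level; _⊔_) renaming (suc to lsuc)
open import Data.Nat using (ℕ; zero; suc)
open import Data.Bool using (Bool; true; false; if_then_else_; _∨_)
open import Data.Fin using (Fin)
open import Data.Vec using (Vec; []; _∷_; zipWith)
open import Data.Vec.Properties using (≡-dec)
open import Data.List using (List; []; _∷_; foldr)
open import Data.List.Relation.Unary.Unique.Propositional using (Unique)
import Data.List.Membership.Propositional as LMem
open import Data.Fin.Subset using (Subset; _∈_; _∉_; _⊆_; _∪_)
open import Data.Product using (Σ; ∃; ∃-syntax; _×_; _,_; proj₁; proj₂)
open import Data.Sum using (_⊎_)
open import Relation.Nullary using (¬_; yes; no)
open import Relation.Binary.PropositionalEquality using (_≡_; _≢_)
open import Function.Bundles using (_⇔_)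
open import Algebra.Bundles using (CommutativeRing; Semiring)
import Algebra.Definitions.RawSemiring as RSDefs
import Data.Bool.Properties as BoolP

record Field (c ℓ : Level) : Set (lsuc (c ⊔ ℓ)) where
  field
    commutativeRing : CommutativeRing c ℓ
  open CommutativeRing commutativeRing public
  field
    0≉1     : ¬ (0# ≈ 1#)
    inverse : ∀ x → ¬ (x ≈ 0#) → ∃[ y ] (x * y ≈ 1#)

CharZero : ∀ {c ℓ} → Field c ℓ → Set ℓ
CharZero F = ∀ (n : ℕ) → ¬ (((suc n) ·1 1#) ≈ 0#)
  where open Field F
        open RSDefs (Semiring.rawSemiring semiring) using () renaming (_×_ to _·1_)

-- Graphs: vertices Fin n, edges labelled by Fin m, edge k has endpoints
-- ends k.  The labelling Fin m also fixes the total order on E.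

record Graph (n m : ℕ) : Set where
  field
    ends : Fin m → Fin n × Fin n

module _ {n m : ℕ} (Γ : Graph n m) where
  open Graph Γ

  Joins : Fin m → Fin n → Fin n → Set
  Joins k v w = (ends k ≡ (v , w)) ⊎ (ends k ≡ (w , v))

  Simple : Set
  Simple = (∀ k → proj₁ (ends k) ≢ proj₂ (ends k))
         × (∀ k l v w → Joins k v w → Joins l v w → k ≡ l)

  data Walk : Fin n → Fin n → List (Fin n) → List (Fin m) → Set where
    nil  : ∀ v → Walk v v (v ∷ []) []
    cons : ∀ {v w x vs es} (k : Fin m) → Joins k v w →
           Walk w x vs es → Walk v x (v ∷ vs) (k ∷ es)

  Connected : Set
  Connected = ∀ v w → ∃[ vs ] ∃[ es ] Walk v w vs es

  Meets : Fin m → Fin n → Set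
  Meets k v = (proj₁ (ends k) ≡ v) ⊎ (proj₂ (ends k) ≡ v)

  BoundaryOK : Subset n → Set
  BoundaryOK B = (∃[ b₁ ] ∃[ b₂ ] (b₁ ∈ B × b₂ ∈ B × b₁ ≢ b₂))
               × (∀ k → ¬ (proj₁ (ends k) ∈ B × proj₂ (ends k) ∈ B))

  BoundaryPathSet : Subset n → Subset m → Set
  BoundaryPathSet B X =
    ∃[ b₁ ] ∃[ b₂ ] ∃[ vs ] ∃[ es ]
      (b₁ ∈ B × b₂ ∈ B × b₁ ≢ b₂ × Walk b₁ b₂ vs es × Unique vs
       × (∀ k → (k ∈ X) ⇔ (k LMem.∈ es)))

  Crossing : Subset n → Subset m → Set
  Crossing B X = BoundaryPathSet B X
               × (∀ Y → Y ⊆ X → BoundaryPathSet B Y → X ⊆ Y)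

  MeetsSet : Subset m → Fin n → Set
  MeetsSet X v = ∃[ k ] (k ∈ X × Meets k v)

-- Exterior algebra over K on generators indexed by Fin N (ordered as Fin).
-- An element is its coefficient function on subsets (monomials e_S).

module Exterior {c ℓ} (F : Field c ℓ) where
  open Field F using (Carrier; _≈_; _+_; _*_; -_; 0#; 1#)

  Ext : ℕ → Set c
  Ext N = Subset N → Carrier

  _≋_ : ∀ {N} → Ext N → Ext N → Set ℓ
  x ≋ y = ∀ S → x S ≈ y S

  sumAll : ∀ {N} → (Subset N → Carrier) → Carrier
  sumAll {zero}  f = f []
  sumAll {suc N} f = sumAll (λ S → f (false ∷ S)) + sumAll (λ S → f (true ∷ S))

  size : ∀ {N} → Subset N → ℕ
  size []          = zero
  size (false ∷ S) = size S
  size (true ∷ S)  = suc (size S)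

  sgnPow : ℕ → Carrier → Carrier
  sgnPow zero    a = a
  sgnPow (suc k) a = - (sgnPow k a)

  -- mulCoef T U S = coefficient of e_S in e_T · e_U
  mulCoef : ∀ {N} → Subset N → Subset N → Subset N → Carrier
  mulCoef [] [] [] = 1#
  mulCoef (true  ∷ T) (true  ∷ U) (s ∷ S) = 0#
  mulCoef (false ∷ T) (false ∷ U) (false ∷ S) = mulCoef T U S
  mulCoef (false ∷ T) (false ∷ U) (true  ∷ S) = 0#
  mulCoef (true  ∷ T) (false ∷ U) (true  ∷ S) = mulCoef T U S
  mulCoef (true  ∷ T) (false ∷ U) (false ∷ S) = 0#
  mulCoef (false ∷ T) (true  ∷ U) (true  ∷ S) = sgnPow (size T) (mulCoef T U S)
  mulCoef (false ∷ T) (true  ∷ U) (false ∷ S) = 0#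

  _+ᴱ_ : ∀ {N} → Ext N → Ext N → Ext N
  (x +ᴱ y) S = x S + y S

  0ᴱ : ∀ {N} → Ext N
  0ᴱ S = 0#

  _·_ : ∀ {N} → Ext N → Ext N → Ext N
  (x · y) S = sumAll (λ T → sumAll (λ U → (x T * y U) * mulCoef T U S))

  e : ∀ {N} → Subset N → Ext N
  e S T with ≡-dec BoolP._≟_ S T
  ... | yes _ = 1#
  ... | no  _ = 0#

  -- dCoef T S = coefficient of e_T in ∂(e_S), where
  -- ∂(e_{a₁}⋯e_{a_p}) = Σ_k (-1)^{k-1} e_{a₁}⋯ê_{a_k}⋯e_{a_p}
  dCoef : ∀ {N} → Subset N → Subset N → Carrier
  dCoef [] [] = 0#
  dCoef (false ∷ T) (false ∷ S) = dCoef T S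
  dCoef (true  ∷ T) (true  ∷ S) = - dCoef T S
  dCoef (true  ∷ T) (false ∷ S) = 0#
  dCoef (false ∷ T) (true  ∷ S) with ≡-dec BoolP._≟_ T S
  ... | yes _ = 1#
  ... | no  _ = 0#

  ∂ : ∀ {N} → Ext N → Ext N
  ∂ x T = sumAll (λ S → dCoef T S * x S)

  _∈⟨_,_⟩ : ∀ {N} → Ext N → Ext N → Ext N → Set (c ⊔ ℓ)
  z ∈⟨ a , b ⟩ =
    ∃[ ts ] (z ≋ foldr (λ (t : Ext _ × Ext _ × Ext _ × Ext _) acc →
                          let (l , r , l′ , r′) = t in
                          ((l · a) · r) +ᴱ (((l′ · b) · r′) +ᴱ acc))
                       0ᴱ ts)

-- The graph hypotheses enter only through one fact, proved at the end: since
-- boundary nodes are pairwise nonadjacent, every edge has an interior endpoint,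
-- so edge sets without a common interior vertex are disjoint.  Elements are
-- coefficient functions, so identities are stated coefficientwise.
--
--  * E(N+1) splits along the first generator e₀: z = z₀ + e₀ z₁ with z₀, z₁
--    free of e₀ ('lower', 'upper'); products and ∂ are computed from the
--    components with the grade involution 'twist' (e₀ x = twist(x) e₀).
--  * By induction on the number of generators this gives the Leibniz rule
--    ∂(xy) = ∂x·y + twist(x)·∂y for all x, y.
--  * For disjoint X, Y, e_{X∪Y} = ε e_X e_Y with ε = ±1, hence
--    ∂e_C = ε(∂e_{X₁} e_{X₂} + (-1)^p e_{X₁} ∂e_{X₂}), p = |X₁|.
--  * With a = ∂(e₀e_{X₁}) = e_{X₁} - e₀∂e_{X₁} and b = ∂(e₀e_{X₂}) this yields
--    ∂e_C = a·(ε(-1)^p ∂e_{X₂}) + (ε ∂e_{X₁})·b, checked componentwise: the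
--    e₀-free parts give the Leibniz expansion of ∂e_C, the e₀-parts cancel.
module Submission where

open import Defs
open import Level using (_⊔_)
open import Data.Nat using (ℕ; zero; suc)
open import Data.Bool using (true; false)
open import Data.Fin using (Fin; zero; suc)
open import Data.Vec using ([]; _∷_; here; there)
open import Data.Vec.Properties using (≡-dec; ∷-injectiveʳ)
open import Data.Fin.Subset using (Subset; _∈_; _∉_; _∪_; _∩_; Empty)
  renaming (⊥ to ∅)
open import Data.Fin.Subset.Properties using (_∈?_; x∈p∩q⁻)
open import Data.Product using (Σ; _×_; _,_; proj₁; proj₂)
open import Data.Sum using (_⊎_; inj₁; inj₂)
open import Data.Empty using (⊥-elim)
open import Data.List using ([]; _∷_)
open import Relation.Nullary using (¬_; yes; no; Dec)
open import Relation.Binary.PropositionalEquality as ≡ using (_≡_)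
import Data.Bool.Properties as BoolP
import Algebra.Solver.CommutativeMonoid as CMSolver

Empty-tail : ∀ {N} a b {X Y : Subset N} → Empty ((a ∷ X) ∩ (b ∷ Y)) → Empty (X ∩ Y)
Empty-tail a b disjoint (k , k∈X∩Y) = disjoint (suc k , there k∈X∩Y)

module ExteriorCalculus {c ℓ} (K : Field c ℓ) where
  open Field K hiding (zero)
  open Exterior K
  open import Algebra.Properties.Ring ring using (-‿distribˡ-*; -‿distribʳ-*)
  open import Algebra.Properties.AbelianGroup +-abelianGroup
    using (⁻¹-∙-comm) renaming (ε⁻¹≈ε to -0≈0; ⁻¹-involutive to -‿involutive)
  open import Relation.Binary.Reasoning.Setoid setoid
  open CMSolver *-commutativeMonoid using ()
    renaming (solve to solve-*; _⊜_ to _⊜*_; _⊕_ to _⊛_)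
  open CMSolver +-commutativeMonoid using ()
    renaming (solve to solve-+; _⊜_ to _⊜+_; _⊕_ to _⊞_)

  -*ˡ : ∀ x y → (- x) * y ≈ - (x * y)
  -*ˡ x y = sym (-‿distribˡ-* x y)

  -*ʳ : ∀ x y → x * (- y) ≈ - (x * y)
  -*ʳ x y = sym (-‿distribʳ-* x y)

  -+ : ∀ x y → - (x + y) ≈ (- x) + (- y)
  -+ x y = sym (⁻¹-∙-comm x y)

  +0 : ∀ {x y} → y ≈ 0# → x + y ≈ x
  +0 {x} p = trans (+-cong refl p) (+-identityʳ x)

  0+ : ∀ {x y} → x ≈ 0# → x + y ≈ y
  0+ {y = y} p = trans (+-cong p refl) (+-identityˡ y)

  +-interchange : ∀ a b c d → (a + b) + (c + d) ≈ (a + c) + (b + d)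
  +-interchange = solve-+ 4 (λ a b c d → (a ⊞ b) ⊞ (c ⊞ d) ⊜+ (a ⊞ c) ⊞ (b ⊞ d)) refl

  sign : ℕ → Carrier
  sign k = sgnPow k 1#

  sgnPow≈sign* : ∀ k a → sgnPow k a ≈ sign k * a
  sgnPow≈sign* zero    a = sym (*-identityˡ a)
  sgnPow≈sign* (suc k) a = trans (-‿cong (sgnPow≈sign* k a)) (-‿distribˡ-* (sign k) a)

  sgnPow-cong : ∀ k {a b} → a ≈ b → sgnPow k a ≈ sgnPow k b
  sgnPow-cong zero    p = p
  sgnPow-cong (suc k) p = -‿cong (sgnPow-cong k p)

  sgnPow-0 : ∀ k → sgnPow k 0# ≈ 0#
  sgnPow-0 zero    = refl
  sgnPow-0 (suc k) = trans (-‿cong (sgnPow-0 k)) -0≈0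

  sgnPow-neg : ∀ k a → sgnPow k (- a) ≈ - sgnPow k a
  sgnPow-neg zero    a = refl
  sgnPow-neg (suc k) a = -‿cong (sgnPow-neg k a)

  sgnPow-+ : ∀ k a b → sgnPow k (a + b) ≈ sgnPow k a + sgnPow k b
  sgnPow-+ zero    a b = refl
  sgnPow-+ (suc k) a b = trans (-‿cong (sgnPow-+ k a b)) (-+ _ _)

  sgnPow-*ˡ : ∀ k a b → a * sgnPow k b ≈ sgnPow k (a * b)
  sgnPow-*ˡ zero    a b = refl
  sgnPow-*ˡ (suc k) a b = trans (-*ʳ _ _) (-‿cong (sgnPow-*ˡ k a b))

  sgnPow-involutive : ∀ k a → sgnPow k (sgnPow k a) ≈ a
  sgnPow-involutive zero    a = refl
  sgnPow-involutive (suc k) a =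
    trans (-‿cong (sgnPow-neg k _)) (trans (-‿involutive _) (sgnPow-involutive k a))

  sumAll-cong : ∀ {N} {f g : Subset N → Carrier} → (∀ S → f S ≈ g S) → sumAll f ≈ sumAll g
  sumAll-cong {zero}          p = p []
  sumAll-cong {suc N} p =
    +-cong (sumAll-cong {N} (λ S → p (false ∷ S))) (sumAll-cong {N} (λ S → p (true ∷ S)))

  sumAll-0 : ∀ {N} {f : Subset N → Carrier} → (∀ S → f S ≈ 0#) → sumAll f ≈ 0#
  sumAll-0 {zero}      p = p []
  sumAll-0 {suc N} p =
    trans (0+ (sumAll-0 {N} (λ S → p (false ∷ S)))) (sumAll-0 {N} (λ S → p (true ∷ S)))

  sumAll-+ : ∀ {N} (f g : Subset N → Carrier) → sumAll (λ S → f S + g S) ≈ sumAll f + sumAll g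
  sumAll-+ {zero}  f g = refl
  sumAll-+ {suc N} f g =
    trans (+-cong (sumAll-+ (λ S → f (false ∷ S)) (λ S → g (false ∷ S)))
                  (sumAll-+ (λ S → f (true ∷ S)) (λ S → g (true ∷ S))))
          (+-interchange _ _ _ _)

  sumAll-*ˡ : ∀ {N} a (f : Subset N → Carrier) → sumAll (λ S → a * f S) ≈ a * sumAll f
  sumAll-*ˡ {zero}  a f = refl
  sumAll-*ˡ {suc N} a f =
    trans (+-cong (sumAll-*ˡ a (λ S → f (false ∷ S))) (sumAll-*ˡ a (λ S → f (true ∷ S))))
          (sym (distribˡ a _ _))

  sumAll-neg : ∀ {N} (f : Subset N → Carrier) → sumAll (λ S → - f S) ≈ - sumAll f
  sumAll-neg {zero}  f = refl
  sumAll-neg {suc N} f =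
    trans (+-cong (sumAll-neg (λ S → f (false ∷ S))) (sumAll-neg (λ S → f (true ∷ S))))
          (⁻¹-∙-comm _ _)

  sumAll-sgnPow : ∀ k {N} (f : Subset N → Carrier) →
                  sumAll (λ S → sgnPow k (f S)) ≈ sgnPow k (sumAll f)
  sumAll-sgnPow k {zero}  f = refl
  sumAll-sgnPow k {suc N} f =
    trans (+-cong (sumAll-sgnPow k (λ S → f (false ∷ S))) (sumAll-sgnPow k (λ S → f (true ∷ S))))
          (sym (sgnPow-+ k _ _))

  ΣΣ : ∀ {N} → (Subset N → Subset N → Carrier) → Carrier
  ΣΣ f = sumAll (λ T → sumAll (λ U → f T U))

  ΣΣ-cong : ∀ {N} {f g : Subset N → Subset N → Carrier} →
            (∀ T U → f T U ≈ g T U) → ΣΣ f ≈ ΣΣ g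
  ΣΣ-cong p = sumAll-cong (λ T → sumAll-cong (p T))

  ΣΣ-0 : ∀ {N} {f : Subset N → Subset N → Carrier} → (∀ T U → f T U ≈ 0#) → ΣΣ f ≈ 0#
  ΣΣ-0 p = sumAll-0 (λ T → sumAll-0 (p T))

  ΣΣ-+ : ∀ {N} (f g : Subset N → Subset N → Carrier) →
         ΣΣ (λ T U → f T U + g T U) ≈ ΣΣ f + ΣΣ g
  ΣΣ-+ f g = trans (sumAll-cong (λ T → sumAll-+ (f T) (g T)))
                   (sumAll-+ (λ T → sumAll (f T)) (λ T → sumAll (g T)))

  ΣΣ-*ˡ : ∀ {N} a (f : Subset N → Subset N → Carrier) → ΣΣ (λ T U → a * f T U) ≈ a * ΣΣ f
  ΣΣ-*ˡ a f = trans (sumAll-cong (λ T → sumAll-*ˡ a (f T))) (sumAll-*ˡ a (λ T → sumAll (f T)))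

  ΣΣ-neg : ∀ {N} (f : Subset N → Subset N → Carrier) → ΣΣ (λ T U → - f T U) ≈ - ΣΣ f
  ΣΣ-neg f = trans (sumAll-cong (λ T → sumAll-neg (f T))) (sumAll-neg (λ T → sumAll (f T)))

  e-diag : ∀ {N} (S : Subset N) → e S S ≈ 1#
  e-diag S with ≡-dec BoolP._≟_ S S
  ... | yes _  = refl
  ... | no S≢S = ⊥-elim (S≢S ≡.refl)

  e-off : ∀ {N} (S T : Subset N) → ¬ (S ≡ T) → e S T ≈ 0#
  e-off S T S≢T with ≡-dec BoolP._≟_ S T
  ... | yes S≡T = ⊥-elim (S≢T S≡T)
  ... | no _    = refl

  e-cons : ∀ {N} b (X T : Subset N) → e (b ∷ X) (b ∷ T) ≈ e X T
  e-cons b X T = by-cases (≡-dec BoolP._≟_ X T)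
    where
    by-cases : Dec (X ≡ T) → e (b ∷ X) (b ∷ T) ≈ e X T
    by-cases (yes ≡.refl) = trans (e-diag (b ∷ X)) (sym (e-diag X))
    by-cases (no X≢T)     =
      trans (e-off (b ∷ X) (b ∷ T) (λ eq → X≢T (∷-injectiveʳ eq))) (sym (e-off X T X≢T))

  e-sym : ∀ {N} (S T : Subset N) → e S T ≈ e T S
  e-sym S T = by-cases (≡-dec BoolP._≟_ S T)
    where
    by-cases : Dec (S ≡ T) → e S T ≈ e T S
    by-cases (yes ≡.refl) = refl
    by-cases (no S≢T)     = trans (e-off S T S≢T) (sym (e-off T S (λ eq → S≢T (≡.sym eq))))

  sum-e : ∀ {N} (X : Subset N) (g : Subset N → Carrier) → sumAll (λ T → e X T * g T) ≈ g X
  sum-e []          g = trans (*-cong (e-diag []) refl) (*-identityˡ _)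
  sum-e (false ∷ X) g = begin
    sumAll (λ T → e (false ∷ X) (false ∷ T) * g (false ∷ T))
      + sumAll (λ T → e (false ∷ X) (true ∷ T) * g (true ∷ T))
      ≈⟨ +0 (sumAll-0 (λ T → trans (*-cong (e-off (false ∷ X) (true ∷ T) (λ ())) refl) (zeroˡ _))) ⟩
    sumAll (λ T → e (false ∷ X) (false ∷ T) * g (false ∷ T))
      ≈⟨ sumAll-cong (λ T → *-cong (e-cons false X T) refl) ⟩
    sumAll (λ T → e X T * g (false ∷ T))
      ≈⟨ sum-e X (λ T → g (false ∷ T)) ⟩
    g (false ∷ X) ∎
  sum-e (true ∷ X)  g = begin
    sumAll (λ T → e (true ∷ X) (false ∷ T) * g (false ∷ T))
      + sumAll (λ T → e (true ∷ X) (true ∷ T) * g (true ∷ T))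
      ≈⟨ 0+ (sumAll-0 (λ T → trans (*-cong (e-off (true ∷ X) (false ∷ T) (λ ())) refl) (zeroˡ _))) ⟩
    sumAll (λ T → e (true ∷ X) (true ∷ T) * g (true ∷ T))
      ≈⟨ sumAll-cong (λ T → *-cong (e-cons true X T) refl) ⟩
    sumAll (λ T → e X T * g (true ∷ T))
      ≈⟨ sum-e X (λ T → g (true ∷ T)) ⟩
    g (true ∷ X) ∎

  sum-e′ : ∀ {N} (X : Subset N) (g : Subset N → Carrier) → sumAll (λ T → g T * e X T) ≈ g X
  sum-e′ X g = trans (sumAll-cong (λ T → *-comm (g T) (e X T))) (sum-e X g)

  _⋆_ : ∀ {N} → Carrier → Ext N → Ext N
  (s ⋆ x) S = s * x S

  -ᴱ_ : ∀ {N} → Ext N → Ext N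
  (-ᴱ x) S = - x S

  twist : ∀ {N} → Ext N → Ext N
  twist x S = sgnPow (size S) (x S)

  -- Splitting along the first generator e₀: z = lower z + e₀ · upper z, and
  -- ι x is x regarded as an element not involving e₀.

  lower : ∀ {N} → Ext (suc N) → Ext N
  lower z S = z (false ∷ S)

  upper : ∀ {N} → Ext (suc N) → Ext N
  upper z S = z (true ∷ S)

  ι : ∀ {N} → Ext N → Ext (suc N)
  ι x (false ∷ S) = x S
  ι x (true ∷ S)  = 0#

  ·-cong : ∀ {N} {x x′ y y′ : Ext N} → (∀ T → x T ≈ x′ T) → (∀ U → y U ≈ y′ U) →
           ∀ S → (x · y) S ≈ (x′ · y′) S
  ·-cong {N} p q S = ΣΣ-cong {N} (λ T U → *-cong (*-cong (p T) (q U)) refl)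

  ·-congˡ : ∀ {N} {x x′ : Ext N} (y : Ext N) → (∀ T → x T ≈ x′ T) → ∀ S → (x · y) S ≈ (x′ · y) S
  ·-congˡ y p = ·-cong p (λ U → refl {y U})

  ·-congʳ : ∀ {N} (x : Ext N) {y y′ : Ext N} → (∀ U → y U ≈ y′ U) → ∀ S → (x · y) S ≈ (x · y′) S
  ·-congʳ x q = ·-cong (λ T → refl {x T}) q

  ·-distribʳ : ∀ {N} (x x′ y : Ext N) S → ((x +ᴱ x′) · y) S ≈ (x · y) S + (x′ · y) S
  ·-distribʳ {N} x x′ y S =
    trans (ΣΣ-cong {N} (λ T U → trans (*-cong (distribʳ (y U) (x T) (x′ T)) refl) (distribʳ _ _ _)))
          (ΣΣ-+ {N} _ _)

  ·-distribˡ : ∀ {N} (x y y′ : Ext N) S → (x · (y +ᴱ y′)) S ≈ (x · y) S + (x · y′) S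
  ·-distribˡ {N} x y y′ S =
    trans (ΣΣ-cong {N} (λ T U → trans (*-cong (distribˡ (x T) (y U) (y′ U)) refl) (distribʳ _ _ _)))
          (ΣΣ-+ {N} _ _)

  ·-negˡ : ∀ {N} (x y : Ext N) S → ((-ᴱ x) · y) S ≈ - (x · y) S
  ·-negˡ {N} x y S = trans (ΣΣ-cong {N} (λ T U → trans (*-cong (-*ˡ _ _) refl) (-*ˡ _ _))) (ΣΣ-neg {N} _)

  ·-negʳ : ∀ {N} (x y : Ext N) S → (x · (-ᴱ y)) S ≈ - (x · y) S
  ·-negʳ {N} x y S = trans (ΣΣ-cong {N} (λ T U → trans (*-cong (-*ʳ _ _) refl) (-*ˡ _ _))) (ΣΣ-neg {N} _)

  ·-⋆ˡ : ∀ {N} s (x y : Ext N) S → ((s ⋆ x) · y) S ≈ s * (x · y) S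
  ·-⋆ˡ {N} s x y S = trans (ΣΣ-cong {N} (λ T U → reassoc s (x T) (y U) _)) (ΣΣ-*ˡ {N} s _)
    where
    reassoc : ∀ s a b m → ((s * a) * b) * m ≈ s * ((a * b) * m)
    reassoc = solve-* 4 (λ s a b m → ((s ⊛ a) ⊛ b) ⊛ m ⊜* s ⊛ ((a ⊛ b) ⊛ m)) refl

  ·-⋆ʳ : ∀ {N} s (x y : Ext N) S → (x · (s ⋆ y)) S ≈ s * (x · y) S
  ·-⋆ʳ {N} s x y S = trans (ΣΣ-cong {N} (λ T U → reassoc s (x T) (y U) _)) (ΣΣ-*ˡ {N} s _)
    where
    reassoc : ∀ s a b m → (a * (s * b)) * m ≈ s * ((a * b) * m)
    reassoc = solve-* 4 (λ s a b m → (a ⊛ (s ⊛ b)) ⊛ m ⊜* s ⊛ ((a ⊛ b) ⊛ m)) refl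

  ·-zeroˡ : ∀ {N} (y : Ext N) S → (0ᴱ · y) S ≈ 0#
  ·-zeroˡ {N} y S = ΣΣ-0 {N} (λ T U → trans (*-cong (zeroˡ _) refl) (zeroˡ _))

  ·-zeroʳ : ∀ {N} (x : Ext N) S → (x · 0ᴱ) S ≈ 0#
  ·-zeroʳ {N} x S = ΣΣ-0 {N} (λ T U → trans (*-cong (zeroʳ _) refl) (zeroˡ _))

  -- Products split along e₀: the e₀-free part of xy is x₀y₀, and since
  -- e₀ anticommutes with odd elements, the e₀-part is x₁y₀ + twist(x₀)y₁.

  lower-· : ∀ {N} (x y : Ext (suc N)) S → (x · y) (false ∷ S) ≈ (lower x · lower y) S
  lower-· {N} x y S =
    trans (+0 (sumAll-0 {N} (λ T → trans (+-cong (sumAll-0 {N} (λ U → zeroʳ _))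
                                                  (sumAll-0 {N} (λ U → zeroʳ _)))
                                          (+-identityˡ 0#))))
          (sumAll-cong {N} (λ T → +0 (sumAll-0 {N} (λ U → zeroʳ _))))

  upper-· : ∀ {N} (x y : Ext (suc N)) S →
            (x · y) (true ∷ S) ≈ (upper x · lower y) S + (twist (lower x) · upper y) S
  upper-· {N} x y S = begin
    (x · y) (true ∷ S)
      ≈⟨ +-cong (sumAll-cong {N} (λ T → 0+ (sumAll-0 {N} (λ U → zeroʳ _))))
                (sumAll-cong {N} (λ T → +0 (sumAll-0 {N} (λ U → zeroʳ _)))) ⟩
    ΣΣ (λ T U → (x (false ∷ T) * y (true ∷ U)) * sgnPow (size T) (mulCoef T U S))
      + ΣΣ (λ T U → (x (true ∷ T) * y (false ∷ U)) * mulCoef T U S)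
      ≈⟨ +-cong (ΣΣ-cong (λ T U → move-sign (size T) (x (false ∷ T)) (y (true ∷ U)) _)) refl ⟩
    (twist (lower x) · upper y) S + (upper x · lower y) S
      ≈⟨ +-comm _ _ ⟩
    (upper x · lower y) S + (twist (lower x) · upper y) S ∎
    where
    swap : ∀ a b s m → (a * b) * (s * m) ≈ ((s * a) * b) * m
    swap = solve-* 4 (λ a b s m → (a ⊛ b) ⊛ (s ⊛ m) ⊜* ((s ⊛ a) ⊛ b) ⊛ m) refl
    move-sign : ∀ k a b m → (a * b) * sgnPow k m ≈ (sgnPow k a * b) * m
    move-sign k a b m =
      trans (*-cong refl (sgnPow≈sign* k m))
            (trans (swap a b (sign k) m) (*-cong (*-cong (sym (sgnPow≈sign* k a)) refl) refl))

  dCoef-drop-first : ∀ {N} (T S : Subset N) → dCoef (false ∷ T) (true ∷ S) ≈ e T S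
  dCoef-drop-first T S with ≡-dec BoolP._≟_ T S
  ... | yes _ = refl
  ... | no _  = refl

  dCoef-degree : ∀ {N} (T S : Subset N) → dCoef T S ≈ 0# ⊎ size S ≡ suc (size T)
  dCoef-degree []          []          = inj₁ refl
  dCoef-degree (false ∷ T) (false ∷ S) = dCoef-degree T S
  dCoef-degree (true ∷ T)  (true ∷ S)  with dCoef-degree T S
  ... | inj₁ d≈0  = inj₁ (trans (-‿cong d≈0) -0≈0)
  ... | inj₂ size≡ = inj₂ (≡.cong suc size≡)
  dCoef-degree (true ∷ T)  (false ∷ S) = inj₁ refl
  dCoef-degree (false ∷ T) (true ∷ S)  = by-cases (≡-dec BoolP._≟_ T S)
    where
    by-cases : Dec (T ≡ S) → dCoef (false ∷ T) (true ∷ S) ≈ 0# ⊎ suc (size S) ≡ suc (size T)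
    by-cases (yes ≡.refl) = inj₂ ≡.refl
    by-cases (no T≢S)     = inj₁ (trans (dCoef-drop-first T S) (e-off T S T≢S))

  ∂-e : ∀ {N} (X T : Subset N) → ∂ (e X) T ≈ dCoef T X
  ∂-e X T = sum-e′ X (dCoef T)

  ∂-cong : ∀ {N} {z z′ : Ext N} → (∀ S → z S ≈ z′ S) → ∀ T → ∂ z T ≈ ∂ z′ T
  ∂-cong p T = sumAll-cong (λ S → *-cong refl (p S))

  ∂-+ : ∀ {N} (z z′ : Ext N) T → ∂ (z +ᴱ z′) T ≈ ∂ z T + ∂ z′ T
  ∂-+ {N} z z′ T = trans (sumAll-cong {N} (λ S → distribˡ (dCoef T S) (z S) (z′ S))) (sumAll-+ {N} _ _)

  ∂-⋆ : ∀ {N} s (z : Ext N) T → ∂ (s ⋆ z) T ≈ s * ∂ z T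
  ∂-⋆ {N} s z T = trans (sumAll-cong {N} (λ S → commute (dCoef T S) s (z S))) (sumAll-*ˡ {N} s _)
    where
    commute : ∀ d s a → d * (s * a) ≈ s * (d * a)
    commute = solve-* 3 (λ d s a → d ⊛ (s ⊛ a) ⊜* s ⊛ (d ⊛ a)) refl

  ∂-lower : ∀ {N} (z : Ext (suc N)) T → ∂ z (false ∷ T) ≈ ∂ (lower z) T + upper z T
  ∂-lower {N} z T =
    +-cong refl (trans (sumAll-cong {N} (λ S → *-cong (dCoef-drop-first T S) refl)) (sum-e T (upper z)))

  ∂-upper : ∀ {N} (z : Ext (suc N)) T → ∂ z (true ∷ T) ≈ - ∂ (upper z) T
  ∂-upper {N} z T =
    trans (0+ (sumAll-0 {N} (λ S → zeroˡ _)))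
          (trans (sumAll-cong {N} (λ S → -*ˡ (dCoef T S) (upper z S))) (sumAll-neg {N} _))

  twist-∂ : ∀ {N} (z : Ext N) T → twist (∂ z) T ≈ - ∂ (twist z) T
  twist-∂ {N} z T =
    trans (sym (sumAll-sgnPow (size T) {N} _))
          (trans (sumAll-cong {N} (λ S → termwise S (dCoef-degree T S))) (sumAll-neg {N} _))
    where
    termwise : ∀ S → dCoef T S ≈ 0# ⊎ size S ≡ suc (size T) →
               sgnPow (size T) (dCoef T S * z S) ≈ - (dCoef T S * twist z S)
    termwise S (inj₁ d≈0) =
      trans (sgnPow-cong (size T) (trans (*-cong d≈0 refl) (zeroˡ _)))
            (trans (sgnPow-0 (size T))
                   (sym (trans (-‿cong (trans (*-cong d≈0 refl) (zeroˡ _))) -0≈0)))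
    termwise S (inj₂ size≡) rewrite size≡ =
      trans (sym (sgnPow-*ˡ (size T) _ _)) (sym (trans (-‿cong (-*ʳ _ _)) (-‿involutive _)))

  twist-twist : ∀ {N} (z : Ext N) S → twist (twist z) S ≈ z S
  twist-twist z S = sgnPow-involutive (size S) (z S)

  Leibniz : ℕ → Set (c ⊔ ℓ)
  Leibniz N = ∀ (x y : Ext N) T → ∂ (x · y) T ≈ (∂ x · y) T + (twist x · ∂ y) T

  ∂-nullary : ∀ (z : Ext 0) S → ∂ z S ≈ 0#
  ∂-nullary z [] = zeroˡ (z [])

  leibniz-base : Leibniz 0
  leibniz-base x y T = trans (∂-nullary (x · y) T) (sym (begin
    (∂ x · y) T + (twist x · ∂ y) T
      ≈⟨ +-cong (·-congˡ y (∂-nullary x) T) (·-congʳ (twist x) (∂-nullary y) T) ⟩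
    (0ᴱ · y) T + (twist x · 0ᴱ) T
      ≈⟨ trans (+0 (·-zeroʳ (twist x) T)) (·-zeroˡ y T) ⟩
    0# ∎))

  leibniz-lower : ∀ {N} → Leibniz N → ∀ (x y : Ext (suc N)) T →
                  ∂ (x · y) (false ∷ T) ≈ (∂ x · y) (false ∷ T) + (twist x · ∂ y) (false ∷ T)
  leibniz-lower {N} ih x y T = begin
    ∂ (x · y) (false ∷ T)
      ≈⟨ ∂-lower (x · y) T ⟩
    ∂ (lower (x · y)) T + upper (x · y) T
      ≈⟨ +-cong (∂-cong (lower-· x y) T) (upper-· x y T) ⟩
    ∂ (x₀ · y₀) T + ((x₁ · y₀) T + (twist x₀ · y₁) T)
      ≈⟨ +-cong (ih x₀ y₀ T) refl ⟩
    ((∂ x₀ · y₀) T + (twist x₀ · ∂ y₀) T) + ((x₁ · y₀) T + (twist x₀ · y₁) T)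
      ≈⟨ +-interchange _ _ _ _ ⟩
    ((∂ x₀ · y₀) T + (x₁ · y₀) T) + ((twist x₀ · ∂ y₀) T + (twist x₀ · y₁) T)
      ≈⟨ sym (+-cong (·-distribʳ (∂ x₀) x₁ y₀ T) (·-distribˡ (twist x₀) (∂ y₀) y₁ T)) ⟩
    ((∂ x₀ +ᴱ x₁) · y₀) T + (twist x₀ · (∂ y₀ +ᴱ y₁)) T
      ≈⟨ sym (+-cong (·-congˡ y₀ (∂-lower x) T) (·-congʳ (twist x₀) (∂-lower y) T)) ⟩
    (lower (∂ x) · y₀) T + (twist x₀ · lower (∂ y)) T
      ≈⟨ sym (+-cong (lower-· (∂ x) y T) (lower-· (twist x) (∂ y) T)) ⟩
    (∂ x · y) (false ∷ T) + (twist x · ∂ y) (false ∷ T) ∎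
    where
    x₀ x₁ y₀ y₁ : Ext N
    x₀ = lower x
    x₁ = upper x
    y₀ = lower y
    y₁ = upper y

  -- Abelian-group bookkeeping for the e₀-component: the cross terms ±E cancel.
  regroup : ∀ A B C D E → - ((A + B) + (C + D)) ≈ (- A + (- C + E)) + (- (B + E) + - D)
  regroup A B C D E = begin
    - ((A + B) + (C + D))
      ≈⟨ trans (-+ _ _) (+-cong (-+ A B) (-+ C D)) ⟩
    (- A + - B) + (- C + - D)
      ≈⟨ sym (+0 (-‿inverseʳ E)) ⟩
    ((- A + - B) + (- C + - D)) + (E + - E)
      ≈⟨ shuffle (- A) (- B) (- C) (- D) E (- E) ⟩
    (- A + (- C + E)) + ((- B + - E) + - D)
      ≈⟨ +-cong refl (+-cong (sym (-+ B E)) refl) ⟩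
    (- A + (- C + E)) + (- (B + E) + - D) ∎
    where
    shuffle : ∀ a b c d e f → ((a + b) + (c + d)) + (e + f) ≈ (a + (c + e)) + ((b + f) + d)
    shuffle = solve-+ 6 (λ a b c d e f →
      ((a ⊞ b) ⊞ (c ⊞ d)) ⊞ (e ⊞ f) ⊜+ (a ⊞ (c ⊞ e)) ⊞ ((b ⊞ f) ⊞ d)) refl

  leibniz-upper : ∀ {N} → Leibniz N → ∀ (x y : Ext (suc N)) T →
                  ∂ (x · y) (true ∷ T) ≈ (∂ x · y) (true ∷ T) + (twist x · ∂ y) (true ∷ T)
  leibniz-upper {N} ih x y T = begin
    ∂ (x · y) (true ∷ T)
      ≈⟨ ∂-upper (x · y) T ⟩
    - ∂ (upper (x · y)) T
      ≈⟨ -‿cong (trans (∂-cong (upper-· x y) T) (∂-+ (x₁ · y₀) (twist x₀ · y₁) T)) ⟩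
    - (∂ (x₁ · y₀) T + ∂ (twist x₀ · y₁) T)
      ≈⟨ -‿cong (+-cong (ih x₁ y₀ T) (trans (ih (twist x₀) y₁ T)
                                            (+-cong refl (·-congˡ (∂ y₁) (twist-twist x₀) T)))) ⟩
    - (((∂ x₁ · y₀) T + (twist x₁ · ∂ y₀) T) + ((∂ (twist x₀) · y₁) T + (x₀ · ∂ y₁) T))
      ≈⟨ regroup _ _ _ _ ((twist x₁ · y₁) T) ⟩
    (- (∂ x₁ · y₀) T + (- (∂ (twist x₀) · y₁) T + (twist x₁ · y₁) T))
      + (- ((twist x₁ · ∂ y₀) T + (twist x₁ · y₁) T) + - (x₀ · ∂ y₁) T)
      ≈⟨ sym (+-cong (+-cong ∂x·y₀ ∂x·y₁) (+-cong twistx·∂y₀ twistx·∂y₁)) ⟩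
    ((upper (∂ x) · y₀) T + (twist (lower (∂ x)) · y₁) T)
      + ((upper (twist x) · lower (∂ y)) T + (twist (lower (twist x)) · upper (∂ y)) T)
      ≈⟨ sym (+-cong (upper-· (∂ x) y T) (upper-· (twist x) (∂ y) T)) ⟩
    (∂ x · y) (true ∷ T) + (twist x · ∂ y) (true ∷ T) ∎
    where
    x₀ x₁ y₀ y₁ : Ext N
    x₀ = lower x
    x₁ = upper x
    y₀ = lower y
    y₁ = upper y

    ∂x·y₀ : (upper (∂ x) · y₀) T ≈ - (∂ x₁ · y₀) T
    ∂x·y₀ = trans (·-congˡ y₀ (∂-upper x) T) (·-negˡ (∂ x₁) y₀ T)

    twist-lower-∂ : ∀ S → twist (lower (∂ x)) S ≈ ((-ᴱ ∂ (twist x₀)) +ᴱ twist x₁) S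
    twist-lower-∂ S =
      trans (sgnPow-cong (size S) (∂-lower x S))
            (trans (sgnPow-+ (size S) _ _) (+-cong (twist-∂ x₀ S) refl))

    ∂x·y₁ : (twist (lower (∂ x)) · y₁) T ≈ - (∂ (twist x₀) · y₁) T + (twist x₁ · y₁) T
    ∂x·y₁ = trans (·-congˡ y₁ twist-lower-∂ T)
                  (trans (·-distribʳ _ _ y₁ T) (+-cong (·-negˡ (∂ (twist x₀)) y₁ T) refl))

    twistx·∂y₀ : (upper (twist x) · lower (∂ y)) T ≈ - ((twist x₁ · ∂ y₀) T + (twist x₁ · y₁) T)
    twistx·∂y₀ = trans (·-congʳ (-ᴱ twist x₁) (∂-lower y) T)
                       (trans (·-negˡ (twist x₁) _ T) (-‿cong (·-distribˡ (twist x₁) (∂ y₀) y₁ T)))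

    twistx·∂y₁ : (twist (lower (twist x)) · upper (∂ y)) T ≈ - (x₀ · ∂ y₁) T
    twistx·∂y₁ = trans (·-cong (twist-twist x₀) (∂-upper y) T) (·-negʳ x₀ (∂ y₁) T)

  leibniz : ∀ N → Leibniz N
  leibniz zero    = leibniz-base
  leibniz (suc N) x y (false ∷ T) = leibniz-lower (leibniz N) x y T
  leibniz (suc N) x y (true ∷ T)  = leibniz-upper (leibniz N) x y T

  e-· : ∀ {N} (X : Subset N) (y : Ext N) S → (e X · y) S ≈ sumAll (λ U → y U * mulCoef X U S)
  e-· {N} X y S =
    trans (sumAll-cong {N} (λ T → trans (sumAll-cong {N} (λ U → *-assoc (e X T) (y U) _))
                                        (sumAll-*ˡ {N} (e X T) _)))
          (sum-e X (λ T → sumAll (λ U → y U * mulCoef T U S)))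

  ·-e : ∀ {N} (x : Ext N) (Y : Subset N) S → (x · e Y) S ≈ sumAll (λ T → x T * mulCoef T Y S)
  ·-e {N} x Y S =
    sumAll-cong {N} (λ T → trans (sumAll-cong {N} (λ U → rearrange (x T) (e Y U) _))
                                 (sum-e Y (λ U → x T * mulCoef T U S)))
    where
    rearrange : ∀ a b m → (a * b) * m ≈ b * (a * m)
    rearrange = solve-* 3 (λ a b m → (a ⊛ b) ⊛ m ⊜* b ⊛ (a ⊛ m)) refl

  size-∅ : ∀ {N} → size (∅ {N}) ≡ 0
  size-∅ {zero}  = ≡.refl
  size-∅ {suc N} = size-∅ {N}

  mulCoef-∅ˡ : ∀ {N} (U S : Subset N) → mulCoef ∅ U S ≈ e U S
  mulCoef-∅ˡ []          []          = sym (e-diag [])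
  mulCoef-∅ˡ (false ∷ U) (false ∷ S) = trans (mulCoef-∅ˡ U S) (sym (e-cons false U S))
  mulCoef-∅ˡ (false ∷ U) (true ∷ S)  = sym (e-off (false ∷ U) (true ∷ S) (λ ()))
  mulCoef-∅ˡ {suc N} (true ∷ U) (true ∷ S) rewrite size-∅ {N} =
    trans (mulCoef-∅ˡ U S) (sym (e-cons true U S))
  mulCoef-∅ˡ (true ∷ U)  (false ∷ S) = sym (e-off (true ∷ U) (false ∷ S) (λ ()))

  mulCoef-∅ʳ : ∀ {N} (T S : Subset N) → mulCoef T ∅ S ≈ e T S
  mulCoef-∅ʳ []          []          = sym (e-diag [])
  mulCoef-∅ʳ (false ∷ T) (false ∷ S) = trans (mulCoef-∅ʳ T S) (sym (e-cons false T S))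
  mulCoef-∅ʳ (false ∷ T) (true ∷ S)  = sym (e-off (false ∷ T) (true ∷ S) (λ ()))
  mulCoef-∅ʳ (true ∷ T)  (true ∷ S)  = trans (mulCoef-∅ʳ T S) (sym (e-cons true T S))
  mulCoef-∅ʳ (true ∷ T)  (false ∷ S) = sym (e-off (true ∷ T) (false ∷ S) (λ ()))

  ·-identityˡ : ∀ {N} (x : Ext N) S → (e ∅ · x) S ≈ x S
  ·-identityˡ x S =
    trans (e-· ∅ x S)
          (trans (sumAll-cong (λ U → *-cong refl (trans (mulCoef-∅ˡ U S) (e-sym U S)))) (sum-e′ S x))

  ·-identityʳ : ∀ {N} (x : Ext N) S → (x · e ∅) S ≈ x S
  ·-identityʳ x S =
    trans (·-e x ∅ S)
          (trans (sumAll-cong (λ T → *-cong refl (trans (mulCoef-∅ʳ T S) (e-sym T S)))) (sum-e′ S x))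

  -- Products of monomials: e_X e_Y = ε e_{X∪Y} where ε = unionSign X Y is
  -- ±1 when X and Y are disjoint.

  unionSign : ∀ {N} → Subset N → Subset N → Carrier
  unionSign X Y = mulCoef X Y (X ∪ Y)

  e·e : ∀ {N} (X Y S : Subset N) → (e X · e Y) S ≈ mulCoef X Y S
  e·e X Y S = trans (e-· X (e Y) S) (sum-e Y (λ U → mulCoef X U S))

  mulCoef-support : ∀ {N} (X Y S : Subset N) → mulCoef X Y S ≈ 0# ⊎ S ≡ X ∪ Y
  mulCoef-support []          []          []          = inj₂ ≡.refl
  mulCoef-support (true ∷ X)  (true ∷ Y)  (s ∷ S)     = inj₁ refl
  mulCoef-support (false ∷ X) (false ∷ Y) (false ∷ S) with mulCoef-support X Y S
  ... | inj₁ m≈0  = inj₁ m≈0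
  ... | inj₂ S≡X∪Y = inj₂ (≡.cong (false ∷_) S≡X∪Y)
  mulCoef-support (false ∷ X) (false ∷ Y) (true ∷ S)  = inj₁ refl
  mulCoef-support (true ∷ X)  (false ∷ Y) (true ∷ S)  with mulCoef-support X Y S
  ... | inj₁ m≈0  = inj₁ m≈0
  ... | inj₂ S≡X∪Y = inj₂ (≡.cong (true ∷_) S≡X∪Y)
  mulCoef-support (true ∷ X)  (false ∷ Y) (false ∷ S) = inj₁ refl
  mulCoef-support (false ∷ X) (true ∷ Y)  (true ∷ S)  with mulCoef-support X Y S
  ... | inj₁ m≈0  = inj₁ (trans (sgnPow-cong (size X) m≈0) (sgnPow-0 (size X)))
  ... | inj₂ S≡X∪Y = inj₂ (≡.cong (true ∷_) S≡X∪Y)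
  mulCoef-support (false ∷ X) (true ∷ Y)  (false ∷ S) = inj₁ refl

  mulCoef-via-union : ∀ {N} (X Y S : Subset N) → unionSign X Y * e S (X ∪ Y) ≈ mulCoef X Y S
  mulCoef-via-union X Y S = by-cases (≡-dec BoolP._≟_ S (X ∪ Y))
    where
    by-cases : Dec (S ≡ X ∪ Y) → unionSign X Y * e S (X ∪ Y) ≈ mulCoef X Y S
    by-cases (yes ≡.refl) = trans (*-cong refl (e-diag S)) (*-identityʳ _)
    by-cases (no S≢X∪Y) with mulCoef-support X Y S
    ... | inj₁ m≈0    = trans (*-cong refl (e-off S (X ∪ Y) S≢X∪Y)) (trans (zeroʳ _) (sym m≈0))
    ... | inj₂ S≡X∪Y  = ⊥-elim (S≢X∪Y S≡X∪Y)

  unionSign² : ∀ {N} (X Y : Subset N) → Empty (X ∩ Y) → unionSign X Y * unionSign X Y ≈ 1#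
  unionSign² []          []          _        = *-identityˡ 1#
  unionSign² (true ∷ X)  (true ∷ Y)  disjoint = ⊥-elim (disjoint (zero , here))
  unionSign² (true ∷ X)  (false ∷ Y) disjoint = unionSign² X Y (Empty-tail true false disjoint)
  unionSign² (false ∷ X) (false ∷ Y) disjoint = unionSign² X Y (Empty-tail false false disjoint)
  unionSign² (false ∷ X) (true ∷ Y)  disjoint =
    trans (sgnPow-*ˡ k _ _)
          (trans (sgnPow-cong k (trans (*-comm _ _) (sgnPow-*ˡ k _ _)))
                 (trans (sgnPow-involutive k _) (unionSign² X Y (Empty-tail false true disjoint))))
    where k = size X

  e-∪ : ∀ {N} (X Y : Subset N) → Empty (X ∩ Y) → ∀ S → e (X ∪ Y) S ≈ unionSign X Y * (e X · e Y) S
  e-∪ X Y disjoint S = begin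
    e (X ∪ Y) S                     ≈⟨ trans (e-sym (X ∪ Y) S) (sym (*-identityˡ _)) ⟩
    1# * e S (X ∪ Y)                ≈⟨ *-cong (sym (unionSign² X Y disjoint)) refl ⟩
    (ε * ε) * e S (X ∪ Y)           ≈⟨ *-assoc _ _ _ ⟩
    ε * (ε * e S (X ∪ Y))           ≈⟨ *-cong refl (mulCoef-via-union X Y S) ⟩
    ε * mulCoef X Y S               ≈⟨ *-cong refl (sym (e·e X Y S)) ⟩
    ε * (e X · e Y) S               ∎
    where
    ε : Carrier
    ε = unionSign X Y

  twist-e : ∀ {N} (X : Subset N) S → twist (e X) S ≈ sign (size X) * e X S
  twist-e X S = trans (sgnPow≈sign* (size S) (e X S)) (by-cases (≡-dec BoolP._≟_ X S))
    where
    by-cases : Dec (X ≡ S) → sign (size S) * e X S ≈ sign (size X) * e X S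
    by-cases (yes ≡.refl) = refl
    by-cases (no X≢S)     = trans (*-cong refl (e-off X S X≢S))
                                  (trans (zeroʳ _) (sym (trans (*-cong refl (e-off X S X≢S)) (zeroʳ _))))

  ∂-e-∪ : ∀ {N} (X Y : Subset N) → Empty (X ∩ Y) → ∀ T →
          ∂ (e (X ∪ Y)) T ≈ unionSign X Y * ((∂ (e X) · e Y) T + sign (size X) * (e X · ∂ (e Y)) T)
  ∂-e-∪ {N} X Y disjoint T = begin
    ∂ (e (X ∪ Y)) T
      ≈⟨ trans (∂-cong (e-∪ X Y disjoint) T) (∂-⋆ _ (e X · e Y) T) ⟩
    unionSign X Y * ∂ (e X · e Y) T
      ≈⟨ *-cong refl (leibniz N (e X) (e Y) T) ⟩
    unionSign X Y * ((∂ (e X) · e Y) T + (twist (e X) · ∂ (e Y)) T)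
      ≈⟨ *-cong refl (+-cong refl (trans (·-congˡ (∂ (e Y)) (twist-e X) T) (·-⋆ˡ _ (e X) (∂ (e Y)) T))) ⟩
    unionSign X Y * ((∂ (e X) · e Y) T + sign (size X) * (e X · ∂ (e Y)) T) ∎

  ∂e₀-lower : ∀ {N} (X T : Subset N) → ∂ (e (true ∷ X)) (false ∷ T) ≈ e X T
  ∂e₀-lower X T = trans (∂-e (true ∷ X) (false ∷ T)) (trans (dCoef-drop-first T X) (e-sym T X))

  ∂e₀-upper : ∀ {N} (X T : Subset N) → ∂ (e (true ∷ X)) (true ∷ T) ≈ - ∂ (e X) T
  ∂e₀-upper X T = trans (∂-e (true ∷ X) (true ∷ T)) (-‿cong (sym (∂-e X T)))

  twist-∂e : ∀ {N} (X : Subset N) S → twist (∂ (e X)) S ≈ - (sign (size X) * ∂ (e X) S)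
  twist-∂e X S = trans (twist-∂ (e X) S) (-‿cong (trans (∂-cong (twist-e X) S) (∂-⋆ _ (e X) S)))

  -- For disjoint X₁, X₂ with C = X₁ ∪ X₂, ε = unionSign X₁ X₂ and s = (-1)^|X₁|:
  -- ∂e_C = a · (εs ∂e_{X₂}) + (ε ∂e_{X₁}) · b  with  a = ∂(e₀e_{X₁}), b = ∂(e₀e_{X₂}).
  module _ {N} (X₁ X₂ : Subset N) (disjoint : Empty (X₁ ∩ X₂)) where

    private
      ε s : Carrier
      ε = unionSign X₁ X₂
      s = sign (size X₁)

      a b : Ext (suc N)
      a = ∂ (e (true ∷ X₁))
      b = ∂ (e (true ∷ X₂))

      r l : Ext N
      r = (ε * s) ⋆ ∂ (e X₂)
      l = ε ⋆ ∂ (e X₁)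

    decomposition-lower : ∀ T → ∂ (e (false ∷ (X₁ ∪ X₂))) (false ∷ T) ≈
                                (a · ι r) (false ∷ T) + (ι l · b) (false ∷ T)
    decomposition-lower T = begin
      ∂ (e (false ∷ (X₁ ∪ X₂))) (false ∷ T)
        ≈⟨ trans (∂-e (false ∷ (X₁ ∪ X₂)) (false ∷ T)) (sym (∂-e (X₁ ∪ X₂) T)) ⟩
      ∂ (e (X₁ ∪ X₂)) T
        ≈⟨ ∂-e-∪ X₁ X₂ disjoint T ⟩
      ε * (P + s * Q)
        ≈⟨ trans (distribˡ ε P (s * Q)) (+-cong refl (sym (*-assoc ε s Q))) ⟩
      ε * P + (ε * s) * Q
        ≈⟨ +-comm _ _ ⟩
      (ε * s) * Q + ε * P
        ≈⟨ sym (+-cong (·-⋆ʳ (ε * s) (e X₁) (∂ (e X₂)) T) (·-⋆ˡ ε (∂ (e X₁)) (e X₂) T)) ⟩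
      (e X₁ · r) T + (l · e X₂) T
        ≈⟨ sym (+-cong (·-congˡ r (∂e₀-lower X₁) T) (·-congʳ l (∂e₀-lower X₂) T)) ⟩
      (lower a · r) T + (l · lower b) T
        ≈⟨ sym (+-cong (lower-· a (ι r) T) (lower-· (ι l) b T)) ⟩
      (a · ι r) (false ∷ T) + (ι l · b) (false ∷ T) ∎
      where
      P Q : Carrier
      P = (∂ (e X₁) · e X₂) T
      Q = (e X₁ · ∂ (e X₂)) T

    -- e₀-component: both summands are ∓εs ∂e_{X₁}∂e_{X₂}, and they cancel.
    decomposition-upper : ∀ T → ∂ (e (false ∷ (X₁ ∪ X₂))) (true ∷ T) ≈
                                (a · ι r) (true ∷ T) + (ι l · b) (true ∷ T)
    decomposition-upper T = sym (begin
      (a · ι r) (true ∷ T) + (ι l · b) (true ∷ T)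
        ≈⟨ +-cong (trans (upper-· a (ι r) T) (+0 (·-zeroʳ (twist (lower a)) T)))
                  (trans (upper-· (ι l) b T) (0+ (·-zeroˡ (lower b) T))) ⟩
      (upper a · r) T + (twist l · upper b) T
        ≈⟨ +-cong (·-congˡ r (∂e₀-upper X₁) T) (·-cong twist-l (∂e₀-upper X₂) T) ⟩
      ((-ᴱ ∂ (e X₁)) · r) T + (((- (ε * s)) ⋆ ∂ (e X₁)) · (-ᴱ ∂ (e X₂))) T
        ≈⟨ +-cong (trans (·-negˡ (∂ (e X₁)) r T) (-‿cong (·-⋆ʳ (ε * s) (∂ (e X₁)) (∂ (e X₂)) T)))
                  (trans (·-negʳ _ (∂ (e X₂)) T) (-‿cong (·-⋆ˡ (- (ε * s)) (∂ (e X₁)) (∂ (e X₂)) T))) ⟩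
      - ((ε * s) * R) + - ((- (ε * s)) * R)
        ≈⟨ +-cong refl (trans (-‿cong (-*ˡ (ε * s) R)) (-‿involutive _)) ⟩
      - ((ε * s) * R) + (ε * s) * R
        ≈⟨ -‿inverseˡ _ ⟩
      0#
        ≈⟨ sym (∂-e (false ∷ (X₁ ∪ X₂)) (true ∷ T)) ⟩
      ∂ (e (false ∷ (X₁ ∪ X₂))) (true ∷ T) ∎)
      where
      R : Carrier
      R = (∂ (e X₁) · ∂ (e X₂)) T

      twist-l : ∀ S → twist l S ≈ ((- (ε * s)) ⋆ ∂ (e X₁)) S
      twist-l S = begin
        sgnPow (size S) (ε * ∂ (e X₁) S) ≈⟨ sym (sgnPow-*ˡ (size S) ε _) ⟩
        ε * twist (∂ (e X₁)) S           ≈⟨ *-cong refl (twist-∂e X₁ S) ⟩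
        ε * - (s * ∂ (e X₁) S)           ≈⟨ trans (-*ʳ _ _) (-‿cong (sym (*-assoc _ _ _))) ⟩
        - ((ε * s) * ∂ (e X₁) S)         ≈⟨ sym (-*ˡ _ _) ⟩
        (- (ε * s)) * ∂ (e X₁) S         ∎

    ∂e-∪∈ideal : ∂ (e (false ∷ (X₁ ∪ X₂))) ∈⟨ a , b ⟩
    ∂e-∪∈ideal = (e ∅ , ι r , ι l , e ∅) ∷ [] , λ S → begin
      ∂ (e (false ∷ (X₁ ∪ X₂))) S       ≈⟨ decomposition S ⟩
      (a · ι r) S + (ι l · b) S
        ≈⟨ sym (+-cong (·-congˡ (ι r) (·-identityˡ a) S) (trans (+0 refl) (·-identityʳ (ι l · b) S))) ⟩
      ((e ∅ · a) · ι r) S + (((ι l · b) · e ∅) S + 0#) ∎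
      where
      decomposition : ∀ S → ∂ (e (false ∷ (X₁ ∪ X₂))) S ≈ (a · ι r) S + (ι l · b) S
      decomposition (false ∷ T) = decomposition-lower T
      decomposition (true ∷ T)  = decomposition-upper T

interior-endpoint : ∀ {n m} (Γ : Graph n m) (B : Subset n) →
  (∀ k → ¬ (proj₁ (Graph.ends Γ k) ∈ B × proj₂ (Graph.ends Γ k) ∈ B)) →
  ∀ k → Σ (Fin n) (λ v → v ∉ B × Meets Γ k v)
interior-endpoint Γ B nonadjacent k with proj₁ (Graph.ends Γ k) ∈? B
... | no  v∉B = proj₁ (Graph.ends Γ k) , v∉B , inj₁ ≡.refl
... | yes v∈B = proj₂ (Graph.ends Γ k) , (λ w∈B → nonadjacent k (v∈B , w∈B)) , inj₂ ≡.refl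

edge-disjoint : ∀ {n m} (Γ : Graph n m) (B : Subset n) →
  (∀ k → ¬ (proj₁ (Graph.ends Γ k) ∈ B × proj₂ (Graph.ends Γ k) ∈ B)) →
  (X₁ X₂ : Subset m) → (∀ v → v ∉ B → ¬ (MeetsSet Γ X₁ v × MeetsSet Γ X₂ v)) →
  Empty (X₁ ∩ X₂)
edge-disjoint Γ B nonadjacent X₁ X₂ no-common-vertex (k , k∈X₁∩X₂)
  with interior-endpoint Γ B nonadjacent k | x∈p∩q⁻ X₁ X₂ k∈X₁∩X₂
... | v , v∉B , k-meets-v | k∈X₁ , k∈X₂ =
  no-common-vertex v v∉B ((k , k∈X₁ , k-meets-v) , (k , k∈X₂ , k-meets-v))

lemma3p5 : ∀ {c ℓ} (K : Field c ℓ) → CharZero K →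
    ∀ {n m} (Γ : Graph n m) → Simple Γ → Connected Γ →
    (B : Subset n) → BoundaryOK Γ B →
    (u : Fin n → Field.Carrier K) →
    (∀ i j → i ∈ B → j ∈ B → Field._≈_ K (u i) (u j) → i ≡ j) →
    (X₁ X₂ : Subset m) → Crossing Γ B X₁ → Crossing Γ B X₂ →
    (∀ v → v ∉ B → ¬ (MeetsSet Γ X₁ v × MeetsSet Γ X₂ v)) →
    let open Exterior K in
    ∂ (e (false ∷ (X₁ ∪ X₂))) ∈⟨ ∂ (e (true ∷ X₁)) , ∂ (e (true ∷ X₂)) ⟩
lemma3p5 K _ Γ _ _ B (_ , nonadjacent) _ _ X₁ X₂ _ _ no-common-vertex =
  ExteriorCalculus.∂e-∪∈ideal K X₁ X₂ (edge-disjoint Γ B nonadjacent X₁ X₂ no-common-vertex)
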